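{- Let $\eta,\eta'\in\{0,1\}$. If $\vdash_\eta P$ and $\langle\eta;P\rangle\xrightarrow{\mu}\langle\eta';P'\rangle$, then $\vdash_{\eta'}P'$.
   Context: Asynchronous $\pi$-calculus: processes $P ::= a\langle\tilde b\rangle \mid\ !a(\tilde b).P \mid P|Q \mid (\nu a)P \mid G$, $G ::= \mathbf 0 \mid a(\tilde b).P \mid \tau.P \mid [a=b]G \mid G+G'$, well-sorted under a fixed sorting; $P\xrightarrow{\mu}P'$ is the standard early LTS of the asynchronous $\pi$-calculus with actions $\tau$, early inputs $a(\tilde b)$ and outputs $(\nu\tilde c)a\langle\tilde b\rangle$ (subject $a$). Names are partitioned into output-controlled ($x,y,z$) and input-controlled ($u,v,w$). Judgements $\vdash_\eta P$, $\eta\in\{0,1\}$: $\vdash_1 u(\tilde a).P$ if $\vdash_1P$; $\vdash_0 x(\tilde a).P$, $\vdash_0 !x(\tilde a).P$ if $\vdash_1P$; $\vdash_1x\langle\tilde a\rangle$; $\vdash_0u\langle\tilde a\rangle$; $\vdash_\eta(\nu a)P$ if $\vdash_\eta P$; $\vdash_0\mathbf0$; $\vdash_{\eta_1+\eta_2}P|Q$ if $\vdash_{\eta_1}P$, $\vdash_{\eta_2}Q$, $\eta_1+\eta_2\le1$; $\vdash_\eta G_1+G_2$ if $\vdash_\eta G_1,G_2$; $\vdash_\eta\tau.P$ if $\vdash_\eta P$; $\vdash_0[a=b]G$ if $\vdash_0G$. A type-allowed transition $\eta\vdash P\xrightarrow{\mu}P'$ holds if $\vdash_\eta P$, $P\xrightarrow{\mu}P'$,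 and $\eta=0$, or $\mu=\tau$, or $\eta=1$ and $\mu$ is an input at an input-controlled name or an output at an output-controlled name. $\langle\eta;P\rangle\xrightarrow{\mu}\langle\eta';P'\rangle$ holds if $\eta\vdash P\xrightarrow{\mu}P'$ and $\eta'=1$ when $\mu$ is an input at an output-controlled name, $\eta'=0$ when $\mu$ is an output at an output-controlled name, and $\eta'=\eta$ otherwise. -}

module Defs where

open import Data.Nat using (ℕ; zero; suc; _+_; _≤_)
open import Data.List using (List; []; _∷_; _++_)
open import Data.List.Relation.Unary.All using (All; []; _∷_) renaming (map to mapAll)
open import Data.Product using (_×_; _,_)
open import Relation.Binary.PropositionalEquality using (_≡_)

data Ctrl : Set where
  outCtrl : Ctrl
  inCtrl  : Ctrl

-- Every sort belongs to one class of the
-- partition (so the sorting respects the partition), and carries the list of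
-- sorts of the objects carried by names of that sort.
record Sorting : Set₁ where
  field
    Sort : Set
    ctrl : Sort → Ctrl
    obj  : Sort → List Sort

module Pi (𝒮 : Sorting) where
  open Sorting 𝒮

  Ctx : Set
  Ctx = List Sort

  data _∋_ : Ctx → Sort → Set where
    ze : ∀ {Γ s} → (s ∷ Γ) ∋ s
    su : ∀ {Γ s t} → Γ ∋ s → (t ∷ Γ) ∋ s

  Names : Ctx → List Sort → Set
  Names Γ ts = All (Γ ∋_) ts

  mutual
    data Proc (Γ : Ctx) : Set where
      out   : ∀ {s} → Γ ∋ s → Names Γ (obj s) → Proc Γ
      rep   : ∀ {s} → Γ ∋ s → Proc (obj s ++ Γ) → Proc Γ
      _∣_   : Proc Γ → Proc Γ → Proc Γ
      ν     : (s : Sort) → Proc (s ∷ Γ) → Proc Γ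
      guard : Guard Γ → Proc Γ

    data Guard (Γ : Ctx) : Set where
      nil   : Guard Γ
      inp   : ∀ {s} → Γ ∋ s → Proc (obj s ++ Γ) → Guard Γ
      tau   : Proc Γ → Guard Γ
      match : ∀ {s} → Γ ∋ s → Γ ∋ s → Guard Γ → Guard Γ
      _⊕_   : Guard Γ → Guard Γ → Guard Γ

  Ren : Ctx → Ctx → Set
  Ren Γ Δ = ∀ {s} → Γ ∋ s → Δ ∋ s

  lift : ∀ {Γ Δ} Ξ → Ren Γ Δ → Ren (Ξ ++ Γ) (Ξ ++ Δ)
  lift []      ρ x      = ρ x
  lift (t ∷ Ξ) ρ ze     = ze
  lift (t ∷ Ξ) ρ (su x) = su (lift Ξ ρ x)

  mutual
    renP : ∀ {Γ Δ} → Ren Γ Δ → Proc Γ → Proc Δ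
    renP ρ (out a bs)    = out (ρ a) (mapAll ρ bs)
    renP ρ (rep {s} a P) = rep (ρ a) (renP (lift (obj s) ρ) P)
    renP ρ (P ∣ Q)       = renP ρ P ∣ renP ρ Q
    renP ρ (ν s P)       = ν s (renP (lift (s ∷ []) ρ) P)
    renP ρ (guard G)     = guard (renG ρ G)

    renG : ∀ {Γ Δ} → Ren Γ Δ → Guard Γ → Guard Δ
    renG ρ nil           = nil
    renG ρ (inp {s} a P) = inp (ρ a) (renP (lift (obj s) ρ) P)
    renG ρ (tau P)       = tau (renP ρ P)
    renG ρ (match a b G) = match (ρ a) (ρ b) (renG ρ G)
    renG ρ (G ⊕ H)       = renG ρ G ⊕ renG ρ H

  inst : ∀ {Γ} Ξ → Names Γ Ξ → Ren (Ξ ++ Γ) Γ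
  inst []      []       x      = x
  inst (t ∷ Ξ) (b ∷ bs) ze     = b
  inst (t ∷ Ξ) (b ∷ bs) (su x) = inst Ξ bs x

  -- extending a context by extruded names (the head of Δ is innermost... i.e.
  -- (s ∷ Δ) ⋈ Γ = Δ ⋈ (s ∷ Γ))
  _⋈_ : List Sort → Ctx → Ctx
  []      ⋈ Γ = Γ
  (s ∷ Δ) ⋈ Γ = Δ ⋈ (s ∷ Γ)

  wkR : ∀ {Γ} Δ → Ren Γ (Δ ⋈ Γ)
  wkR []      x = x
  wkR (s ∷ Δ) x = wkR Δ (su x)

  liftΔ : ∀ {Γ Γ'} Δ → Ren Γ Γ' → Ren (Δ ⋈ Γ) (Δ ⋈ Γ')
  liftΔ []      ρ x = ρ x
  liftΔ (t ∷ Δ) ρ x = liftΔ Δ (lift (t ∷ []) ρ) x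

  swap01 : ∀ {Γ s t} → Ren (t ∷ s ∷ Γ) (s ∷ t ∷ Γ)
  swap01 ze          = su ze
  swap01 (su ze)     = ze
  swap01 (su (su x)) = su (su x)

  exR : ∀ {Γ s} Δ → Ren (Δ ⋈ (s ∷ Γ)) (s ∷ (Δ ⋈ Γ))
  exR []      x = x
  exR (t ∷ Δ) x = exR Δ (liftΔ Δ swap01 x)

  νs : ∀ {Γ} Δ → Proc (Δ ⋈ Γ) → Proc Γ
  νs []      P = P
  νs (s ∷ Δ) P = ν s (νs Δ P)

  -- Actions: τ, early input a(b̃), output (ν Δ) a⟨b̃⟩ (Δ = extruded names)

  data Act (Γ : Ctx) : Ctx → Set where
    τ    : Act Γ Γ
    inpA : ∀ {s} → Γ ∋ s → Names Γ (obj s) → Act Γ Γ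
    outA : ∀ Δ {s} → Γ ∋ s → Names (Δ ⋈ Γ) (obj s) → Act Γ (Δ ⋈ Γ)

  wkAct : ∀ {Γ Γ'} → Act Γ Γ' → Proc Γ → Proc Γ'
  wkAct τ            P = P
  wkAct (inpA a bs)  P = P
  wkAct (outA Δ a bs) P = renP (wkR Δ) P

  data Occ {Γ s} (x : Γ ∋ s) : ∀ {ts} → Names Γ ts → Set where
    hereO  : ∀ {ts} {bs : Names Γ ts} → Occ x (x ∷ bs)
    thereO : ∀ {t ts} {b : Γ ∋ t} {bs : Names Γ ts} → Occ x bs → Occ x (b ∷ bs)

  infix 4 _—[_]→_
  data _—[_]→_ : ∀ {Γ Γ'} → Proc Γ → Act Γ Γ' → Proc Γ' → Set where
    OUT   : ∀ {Γ s} {a : Γ ∋ s} {bs : Names Γ (obj s)} →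
            out a bs —[ outA [] a bs ]→ guard nil
    INP   : ∀ {Γ s} {a : Γ ∋ s} {P} (bs : Names Γ (obj s)) →
            guard (inp a P) —[ inpA a bs ]→ renP (inst (obj s) bs) P
    REP   : ∀ {Γ s} {a : Γ ∋ s} {P} (bs : Names Γ (obj s)) →
            rep a P —[ inpA a bs ]→ (renP (inst (obj s) bs) P ∣ rep a P)
    TAU   : ∀ {Γ} {P : Proc Γ} → guard (tau P) —[ τ ]→ P
    SUML  : ∀ {Γ Γ'} {G H : Guard Γ} {μ : Act Γ Γ'} {P'} →
            guard G —[ μ ]→ P' → guard (G ⊕ H) —[ μ ]→ P'
    SUMR  : ∀ {Γ Γ'} {G H : Guard Γ} {μ : Act Γ Γ'} {P'} →
            guard H —[ μ ]→ P' → guard (G ⊕ H) —[ μ ]→ P'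
    MATCH : ∀ {Γ Γ' s} {a : Γ ∋ s} {G : Guard Γ} {μ : Act Γ Γ'} {P'} →
            guard G —[ μ ]→ P' → guard (match a a G) —[ μ ]→ P'
    PARL  : ∀ {Γ Γ'} {P Q : Proc Γ} {μ : Act Γ Γ'} {P'} →
            P —[ μ ]→ P' → (P ∣ Q) —[ μ ]→ (P' ∣ wkAct μ Q)
    PARR  : ∀ {Γ Γ'} {P Q : Proc Γ} {μ : Act Γ Γ'} {Q'} →
            Q —[ μ ]→ Q' → (P ∣ Q) —[ μ ]→ (wkAct μ P ∣ Q')
    COMML : ∀ {Γ Δ s} {P Q : Proc Γ} {a : Γ ∋ s} {bs : Names (Δ ⋈ Γ) (obj s)} {P' Q'} →
            P —[ outA Δ a bs ]→ P' →
            renP (wkR Δ) Q —[ inpA (wkR Δ a) bs ]→ Q' →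
            (P ∣ Q) —[ τ ]→ νs Δ (P' ∣ Q')
    COMMR : ∀ {Γ Δ s} {P Q : Proc Γ} {a : Γ ∋ s} {bs : Names (Δ ⋈ Γ) (obj s)} {P' Q'} →
            renP (wkR Δ) P —[ inpA (wkR Δ a) bs ]→ P' →
            Q —[ outA Δ a bs ]→ Q' →
            (P ∣ Q) —[ τ ]→ νs Δ (P' ∣ Q')
    RESτ  : ∀ {Γ r} {P P' : Proc (r ∷ Γ)} →
            P —[ τ ]→ P' → ν r P —[ τ ]→ ν r P'
    RESI  : ∀ {Γ r s} {P P' : Proc (r ∷ Γ)} {a : Γ ∋ s} {bs : Names Γ (obj s)} →
            P —[ inpA (su a) (mapAll su bs) ]→ P' → ν r P —[ inpA a bs ]→ ν r P'
    RESO  : ∀ {Γ r s Δ} {P : Proc (r ∷ Γ)} {a : Γ ∋ s} {bs : Names (Δ ⋈ Γ) (obj s)} {P'} →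
            P —[ outA Δ (su a) (mapAll (liftΔ Δ su) bs) ]→ P' →
            ν r P —[ outA Δ a bs ]→ ν r (renP (exR Δ) P')
    OPEN  : ∀ {Γ r s Δ} {P : Proc (r ∷ Γ)} {a : Γ ∋ s} {bs : Names (Δ ⋈ (r ∷ Γ)) (obj s)} {P'} →
            P —[ outA Δ (su a) bs ]→ P' →
            Occ (wkR Δ ze) bs →
            ν r P —[ outA (r ∷ Δ) a bs ]→ P'

  mutual
    data ⊢P {Γ} : ℕ → Proc Γ → Set where
      tInpRep : ∀ {s} {x : Γ ∋ s} {P} → ctrl s ≡ outCtrl → ⊢P 1 P → ⊢P 0 (rep x P)
      tOutO   : ∀ {s} {x : Γ ∋ s} {bs} → ctrl s ≡ outCtrl → ⊢P 1 (out x bs)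
      tOutI   : ∀ {s} {u : Γ ∋ s} {bs} → ctrl s ≡ inCtrl → ⊢P 0 (out u bs)
      tRes    : ∀ {η r} {P : Proc (r ∷ Γ)} → ⊢P η P → ⊢P η (ν r P)
      tPar    : ∀ {η₁ η₂} {P Q} → ⊢P η₁ P → ⊢P η₂ Q → η₁ + η₂ ≤ 1 → ⊢P (η₁ + η₂) (P ∣ Q)
      tGuard  : ∀ {η} {G} → ⊢G η G → ⊢P η (guard G)

    data ⊢G {Γ} : ℕ → Guard Γ → Set where
      tInpI  : ∀ {s} {u : Γ ∋ s} {P} → ctrl s ≡ inCtrl → ⊢P 1 P → ⊢G 1 (inp u P)
      tInpO  : ∀ {s} {x : Γ ∋ s} {P} → ctrl s ≡ outCtrl → ⊢P 1 P → ⊢G 0 (inp x P)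
      tNil   : ⊢G 0 nil
      tSum   : ∀ {η G H} → ⊢G η G → ⊢G η H → ⊢G η (G ⊕ H)
      tTau   : ∀ {η P} → ⊢P η P → ⊢G η (tau P)
      tMatch : ∀ {s} {a b : Γ ∋ s} {G} → ⊢G 0 G → ⊢G 0 (match a b G)

  data Allowed {Γ} : ∀ {Γ'} → ℕ → Act Γ Γ' → Set where
    alZero : ∀ {Γ'} {μ : Act Γ Γ'} → Allowed 0 μ
    alTau  : ∀ {η} → Allowed η τ
    alInp  : ∀ {s} {a : Γ ∋ s} {bs} → ctrl s ≡ inCtrl → Allowed 1 (inpA a bs)
    alOut  : ∀ {Δ s} {a : Γ ∋ s} {bs} → ctrl s ≡ outCtrl → Allowed 1 (outA Δ a bs)

  _⊢_—[_]→_ : ∀ {Γ Γ'} → ℕ → Proc Γ → Act Γ Γ' → Proc Γ' → Set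
  η ⊢ P —[ μ ]→ P' = ⊢P η P × (P —[ μ ]→ P') × Allowed η μ

  nextη : ∀ {Γ Γ'} → ℕ → Act Γ Γ' → ℕ
  nextη η τ = η
  nextη η (inpA {s} a bs) with ctrl s
  ... | outCtrl = 1
  ... | inCtrl  = η
  nextη η (outA Δ {s} a bs) with ctrl s
  ... | outCtrl = 0
  ... | inCtrl  = η

  ⟨_⨾_⟩—[_]→⟨_⨾_⟩ : ∀ {Γ Γ'} → ℕ → Proc Γ → Act Γ Γ' → ℕ → Proc Γ' → Set
  ⟨ η ⨾ P ⟩—[ μ ]→⟨ η' ⨾ P' ⟩ = (η ⊢ P —[ μ ]→ P') × (η' ≡ nextη η μ)

{-# OPTIONS --safe #-}
module Submission where

open import Defs
open import Data.Nat using (ℕ; zero; suc; _+_; _≤_; z≤n; s≤s)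
open import Data.Nat.Properties using (m+n≡0⇒m≡0; m+n≡0⇒n≡0; +-comm)
open import Data.Product using (_×_; _,_; proj₁; proj₂; swap)
open import Data.List using ([]; _∷_)
open import Data.Unit using (⊤; tt)
open import Data.Empty using (⊥; ⊥-elim)
open import Relation.Nullary using (¬_)
open import Relation.Binary.PropositionalEquality using (_≡_; _≢_; refl; subst; sym; trans)

-- The index η records whether a process holds
-- the single "active" capability (an output at an output-controlled name or an
-- input at an input-controlled one).  A process typed at 0 cannot output at an
-- output-controlled name, so in a parallel composition such an output comes from
-- the component typed at 1; it hands the capability over, to the receiver in a
-- communication.  Dually, receiving at an output-controlled name (which creates
-- the capability) is only allowed at level 0, and this side condition is
-- inherited by both components of a parallel composition.

+≤1∧m≢0⇒m≡1∧n≡0 : ∀ {m n} → m + n ≤ 1 → m ≢ 0 → m ≡ 1 × n ≡ 0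
+≤1∧m≢0⇒m≡1∧n≡0 {zero}        _        m≢0 = ⊥-elim (m≢0 refl)
+≤1∧m≢0⇒m≡1∧n≡0 {suc zero} {zero}  _  _   = refl , refl
+≤1∧m≢0⇒m≡1∧n≡0 {suc zero} {suc _} (s≤s ()) _
+≤1∧m≢0⇒m≡1∧n≡0 {suc (suc _)} (s≤s ()) _

+≤1∧n≢0⇒m≡0∧n≡1 : ∀ {m n} → m + n ≤ 1 → n ≢ 0 → m ≡ 0 × n ≡ 1
+≤1∧n≢0⇒m≡0∧n≡1 {m} {n} m+n≤1 n≢0 =
  swap (+≤1∧m≢0⇒m≡1∧n≡0 (subst (_≤ 1) (+-comm m n) m+n≤1) n≢0)

outCtrl≢inCtrl : ∀ {c} → c ≡ outCtrl → c ≢ inCtrl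
outCtrl≢inCtrl refl ()

afterInput : ℕ → Ctrl → ℕ
afterInput η outCtrl = 1
afterInput η inCtrl  = η

afterOutput : ℕ → Ctrl → ℕ
afterOutput η outCtrl = 0
afterOutput η inCtrl  = η

module SubjectReduction (𝒮 : Sorting) where
  open Sorting 𝒮
  open Pi 𝒮

  mutual
    ⊢P-ren : ∀ {Γ Δ η} (ρ : Ren Γ Δ) {P : Proc Γ} → ⊢P η P → ⊢P η (renP ρ P)
    ⊢P-ren ρ (tInpRep e p)  = tInpRep e (⊢P-ren _ p)
    ⊢P-ren ρ (tOutO e)      = tOutO e
    ⊢P-ren ρ (tOutI e)      = tOutI e
    ⊢P-ren ρ (tRes p)       = tRes (⊢P-ren _ p)
    ⊢P-ren ρ (tPar p q le)  = tPar (⊢P-ren ρ p) (⊢P-ren ρ q) le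
    ⊢P-ren ρ (tGuard g)     = tGuard (⊢G-ren ρ g)

    ⊢G-ren : ∀ {Γ Δ η} (ρ : Ren Γ Δ) {G : Guard Γ} → ⊢G η G → ⊢G η (renG ρ G)
    ⊢G-ren ρ (tInpI e p) = tInpI e (⊢P-ren _ p)
    ⊢G-ren ρ (tInpO e p) = tInpO e (⊢P-ren _ p)
    ⊢G-ren ρ tNil        = tNil
    ⊢G-ren ρ (tSum g h)  = tSum (⊢G-ren ρ g) (⊢G-ren ρ h)
    ⊢G-ren ρ (tTau p)    = tTau (⊢P-ren ρ p)
    ⊢G-ren ρ (tMatch g)  = tMatch (⊢G-ren ρ g)

  ⊢P-νs : ∀ {Γ η} Δ {P : Proc (Δ ⋈ Γ)} → ⊢P η P → ⊢P η (νs Δ P)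
  ⊢P-νs []      p = p
  ⊢P-νs (s ∷ Δ) p = tRes (⊢P-νs Δ p)

  -- `nextη` is defined by `with`, which blocks reduction; this is its
  -- structurally recursive equivalent.
  nextLevel : ∀ {Γ Γ'} → ℕ → Act Γ Γ' → ℕ
  nextLevel η τ                 = η
  nextLevel η (inpA {s} a bs)   = afterInput η (ctrl s)
  nextLevel η (outA Δ {s} a bs) = afterOutput η (ctrl s)

  nextη≡nextLevel : ∀ {Γ Γ'} η (μ : Act Γ Γ') → nextη η μ ≡ nextLevel η μ
  nextη≡nextLevel η τ = refl
  nextη≡nextLevel η (inpA {s} a bs) with ctrl s
  ... | outCtrl = refl
  ... | inCtrl  = refl
  nextη≡nextLevel η (outA Δ {s} a bs) with ctrl s
  ... | outCtrl = refl
  ... | inCtrl  = refl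

  OutCtrlInputAtZero : ∀ {Γ Γ'} → ℕ → Act Γ Γ' → Set
  OutCtrlInputAtZero η (inpA {s} a bs) = ctrl s ≡ outCtrl → η ≡ 0
  OutCtrlInputAtZero η _               = ⊤

  Allowed⇒OutCtrlInputAtZero : ∀ {Γ Γ' η} {μ : Act Γ Γ'} → Allowed η μ → OutCtrlInputAtZero η μ
  Allowed⇒OutCtrlInputAtZero {μ = τ}          alZero    = tt
  Allowed⇒OutCtrlInputAtZero {μ = inpA a bs}  alZero    = λ _ → refl
  Allowed⇒OutCtrlInputAtZero {μ = outA Δ a bs} alZero   = tt
  Allowed⇒OutCtrlInputAtZero                  alTau     = tt
  Allowed⇒OutCtrlInputAtZero                  (alInp e) = λ e' → ⊥-elim (outCtrl≢inCtrl e' e)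
  Allowed⇒OutCtrlInputAtZero                  (alOut e) = tt

  IsOutCtrlOutput : ∀ {Γ Γ'} → Act Γ Γ' → Set
  IsOutCtrlOutput (outA Δ {s} a bs) = ctrl s ≡ outCtrl
  IsOutCtrlOutput _                 = ⊥

  ⊢P0⇒¬OutCtrlOutput : ∀ {Γ Γ' η} {P : Proc Γ} {μ : Act Γ Γ'} {P'} →
                       ⊢P η P → η ≡ 0 → P —[ μ ]→ P' → ¬ IsOutCtrlOutput μ
  ⊢P0⇒¬OutCtrlOutput (tOutI e)           _  OUT        o = outCtrl≢inCtrl o e
  ⊢P0⇒¬OutCtrlOutput (tGuard (tSum g h)) z  (SUML t)   o = ⊢P0⇒¬OutCtrlOutput (tGuard g) z t o
  ⊢P0⇒¬OutCtrlOutput (tGuard (tSum g h)) z  (SUMR t)   o = ⊢P0⇒¬OutCtrlOutput (tGuard h) z t o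
  ⊢P0⇒¬OutCtrlOutput (tGuard (tMatch g)) _  (MATCH t)  o = ⊢P0⇒¬OutCtrlOutput (tGuard g) refl t o
  ⊢P0⇒¬OutCtrlOutput (tPar {η₁} p q _)   z  (PARL {μ = outA Δ a bs} t) o =
    ⊢P0⇒¬OutCtrlOutput p (m+n≡0⇒m≡0 η₁ z) t o
  ⊢P0⇒¬OutCtrlOutput (tPar {η₁} p q _)   z  (PARR {μ = outA Δ a bs} t) o =
    ⊢P0⇒¬OutCtrlOutput q (m+n≡0⇒n≡0 η₁ z) t o
  ⊢P0⇒¬OutCtrlOutput (tRes p)            z  (RESO t)   o = ⊢P0⇒¬OutCtrlOutput p z t o
  ⊢P0⇒¬OutCtrlOutput (tRes p)            z  (OPEN t _) o = ⊢P0⇒¬OutCtrlOutput p z t o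

  ⊢P-par-inputˡ : ∀ {Γ η₁ η₂} {P Q : Proc Γ} c → (c ≡ outCtrl → η₁ + η₂ ≡ 0) →
                  ⊢P (afterInput η₁ c) P → ⊢P η₂ Q → η₁ + η₂ ≤ 1 →
                  ⊢P (afterInput (η₁ + η₂) c) (P ∣ Q)
  ⊢P-par-inputˡ {η₁ = η₁} outCtrl h p q _ with m+n≡0⇒n≡0 η₁ (h refl)
  ... | refl = tPar p q (s≤s z≤n)
  ⊢P-par-inputˡ inCtrl _ p q le = tPar p q le

  ⊢P-par-inputʳ : ∀ {Γ η₁ η₂} {P Q : Proc Γ} c → (c ≡ outCtrl → η₁ + η₂ ≡ 0) →
                  ⊢P η₁ P → ⊢P (afterInput η₂ c) Q → η₁ + η₂ ≤ 1 →
                  ⊢P (afterInput (η₁ + η₂) c) (P ∣ Q)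
  ⊢P-par-inputʳ {η₁ = η₁} outCtrl h p q _ with m+n≡0⇒m≡0 η₁ (h refl)
  ... | refl = tPar p q (s≤s z≤n)
  ⊢P-par-inputʳ inCtrl _ p q le = tPar p q le

  ⊢P-par-outputˡ : ∀ {Γ η₁ η₂} {P Q : Proc Γ} c → (c ≡ outCtrl → η₁ ≢ 0) →
                   ⊢P (afterOutput η₁ c) P → ⊢P η₂ Q → η₁ + η₂ ≤ 1 →
                   ⊢P (afterOutput (η₁ + η₂) c) (P ∣ Q)
  ⊢P-par-outputˡ {η₁ = η₁} {η₂} outCtrl h p q le with +≤1∧m≢0⇒m≡1∧n≡0 {η₁} {η₂} le (h refl)
  ... | refl , refl = tPar p q z≤n
  ⊢P-par-outputˡ inCtrl _ p q le = tPar p q le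

  ⊢P-par-outputʳ : ∀ {Γ η₁ η₂} {P Q : Proc Γ} c → (c ≡ outCtrl → η₂ ≢ 0) →
                   ⊢P η₁ P → ⊢P (afterOutput η₂ c) Q → η₁ + η₂ ≤ 1 →
                   ⊢P (afterOutput (η₁ + η₂) c) (P ∣ Q)
  ⊢P-par-outputʳ {η₁ = η₁} {η₂} outCtrl h p q le with +≤1∧n≢0⇒m≡0∧n≡1 {η₁} {η₂} le (h refl)
  ... | refl , refl = tPar p q z≤n
  ⊢P-par-outputʳ inCtrl _ p q le = tPar p q le

  ⊢P-par-commˡ : ∀ {Γ η₁ η₂} {P Q : Proc Γ} c → (c ≡ outCtrl → η₁ ≢ 0) →
                 ⊢P (afterOutput η₁ c) P → ⊢P (afterInput η₂ c) Q → η₁ + η₂ ≤ 1 →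
                 ⊢P (η₁ + η₂) (P ∣ Q)
  ⊢P-par-commˡ {η₁ = η₁} {η₂} outCtrl h p q le with +≤1∧m≢0⇒m≡1∧n≡0 {η₁} {η₂} le (h refl)
  ... | refl , refl = tPar p q (s≤s z≤n)
  ⊢P-par-commˡ inCtrl _ p q le = tPar p q le

  ⊢P-par-commʳ : ∀ {Γ η₁ η₂} {P Q : Proc Γ} c → (c ≡ outCtrl → η₂ ≢ 0) →
                 ⊢P (afterInput η₁ c) P → ⊢P (afterOutput η₂ c) Q → η₁ + η₂ ≤ 1 →
                 ⊢P (η₁ + η₂) (P ∣ Q)
  ⊢P-par-commʳ {η₁ = η₁} {η₂} outCtrl h p q le with +≤1∧n≢0⇒m≡0∧n≡1 {η₁} {η₂} le (h refl)
  ... | refl , refl = tPar p q (s≤s z≤n)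
  ⊢P-par-commʳ inCtrl _ p q le = tPar p q le

  subject-reduction : ∀ {Γ Γ' η} {P : Proc Γ} {μ : Act Γ Γ'} {P'} →
                      ⊢P η P → P —[ μ ]→ P' → OutCtrlInputAtZero η μ →
                      ⊢P (nextLevel η μ) P'
  subject-reduction (tOutO e) OUT _ rewrite e = tGuard tNil
  subject-reduction (tOutI e) OUT _ rewrite e = tGuard tNil
  subject-reduction (tGuard (tInpI e p)) (INP bs) _ rewrite e = ⊢P-ren _ p
  subject-reduction (tGuard (tInpO e p)) (INP bs) _ rewrite e = ⊢P-ren _ p
  subject-reduction (tInpRep e p) (REP bs) _ rewrite e =
    tPar (⊢P-ren _ p) (tInpRep e p) (s≤s z≤n)
  subject-reduction (tGuard (tTau p)) TAU _ = p
  subject-reduction (tGuard (tSum g h)) (SUML t) ok = subject-reduction (tGuard g) t ok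
  subject-reduction (tGuard (tSum g h)) (SUMR t) ok = subject-reduction (tGuard h) t ok
  subject-reduction (tGuard (tMatch g)) (MATCH t) ok = subject-reduction (tGuard g) t ok
  subject-reduction (tPar p q le) (PARL {μ = τ} t) _ = tPar (subject-reduction p t tt) q le
  subject-reduction (tPar {η₁} p q le) (PARL {μ = inpA {s} a bs} t) ok =
    ⊢P-par-inputˡ (ctrl s) ok (subject-reduction p t (λ e → m+n≡0⇒m≡0 η₁ (ok e))) q le
  subject-reduction (tPar p q le) (PARL {μ = outA Δ {s} a bs} t) _ =
    ⊢P-par-outputˡ (ctrl s) (λ e z → ⊢P0⇒¬OutCtrlOutput p z t e)
      (subject-reduction p t tt) (⊢P-ren _ q) le
  subject-reduction (tPar p q le) (PARR {μ = τ} t) _ = tPar p (subject-reduction q t tt) le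
  subject-reduction (tPar {η₁} p q le) (PARR {μ = inpA {s} a bs} t) ok =
    ⊢P-par-inputʳ (ctrl s) ok p (subject-reduction q t (λ e → m+n≡0⇒n≡0 η₁ (ok e))) le
  subject-reduction (tPar p q le) (PARR {μ = outA Δ {s} a bs} t) _ =
    ⊢P-par-outputʳ (ctrl s) (λ e z → ⊢P0⇒¬OutCtrlOutput q z t e)
      (⊢P-ren _ p) (subject-reduction q t tt) le
  subject-reduction (tPar {η₁} p q le) (COMML {Δ = Δ} {s = s} tp tq) _ =
    ⊢P-νs Δ (⊢P-par-commˡ (ctrl s) senderActive (subject-reduction p tp tt)
      (subject-reduction (⊢P-ren _ q) tq (λ e → proj₂ (+≤1∧m≢0⇒m≡1∧n≡0 le (senderActive e)))) le)
    where
    senderActive : ctrl s ≡ outCtrl → η₁ ≢ 0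
    senderActive e z = ⊢P0⇒¬OutCtrlOutput p z tp e
  subject-reduction (tPar {η₂ = η₂} p q le) (COMMR {Δ = Δ} {s = s} tp tq) _ =
    ⊢P-νs Δ (⊢P-par-commʳ (ctrl s) senderActive
      (subject-reduction (⊢P-ren _ p) tp (λ e → proj₁ (+≤1∧n≢0⇒m≡0∧n≡1 le (senderActive e))))
      (subject-reduction q tq tt) le)
    where
    senderActive : ctrl s ≡ outCtrl → η₂ ≢ 0
    senderActive e z = ⊢P0⇒¬OutCtrlOutput q z tq e
  subject-reduction (tRes p) (RESτ t) _ = tRes (subject-reduction p t tt)
  subject-reduction (tRes p) (RESI t) ok = tRes (subject-reduction p t ok)
  subject-reduction (tRes p) (RESO t) _ = tRes (⊢P-ren _ (subject-reduction p t tt))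
  subject-reduction (tRes p) (OPEN t _) _ = subject-reduction p t tt

mainTheorem3 : (𝒮 : Sorting) → let open Pi 𝒮 in
    ∀ {Γ Γ' : Ctx} (η η' : ℕ) → η ≤ 1 → η' ≤ 1 →
    (P : Proc Γ) (μ : Act Γ Γ') (P' : Proc Γ') →
    ⊢P η P → ⟨ η ⨾ P ⟩—[ μ ]→⟨ η' ⨾ P' ⟩ → ⊢P η' P'
mainTheorem3 𝒮 η η' _ _ P μ P' ⊢P ((_ , P→P' , allowed) , η'≡next) =
  subst (λ k → Pi.⊢P 𝒮 k P') (sym (trans η'≡next (nextη≡nextLevel η μ)))
    (subject-reduction ⊢P P→P' (Allowed⇒OutCtrlInputAtZero allowed))
  where open SubjectReduction 𝒮
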